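{- Let $n\geq 1$ and $r$ be integers with $0\leq r\leq n-1$, and let $G_n\in HL_n$. If $g$ is an integer with $2^r\leq g\leq 2^{n-1}$, then $f(g)\geq f(2^r)$, where $f(g)=ng-2e_g$.
   Context: Hypercube-like networks (HL-networks) are defined recursively: $HL_0=\{K_1\}$, and for $n\geq 1$, $HL_n$ is the set of all graphs obtained from the disjoint union of two graphs $G_{n-1},G'_{n-1}\in HL_{n-1}$ by adding the edges of an arbitrary perfect matching between $V(G_{n-1})$ and $V(G'_{n-1})$. Every $G_n\in HL_n$ is $n$-regular with $2^n$ vertices. For $G_n\in HL_n$ and an integer $g$ with $1\le g\le 2^n$, $e_g$ denotes the maximum number of edges of a subgraph of $G_n$ induced by $g$ vertices, and $f(g)=ng-2e_g$. (It is known that if $g=\sum_{i=0}^s2^{t_i}$ with $t_0>t_1>\dots>t_s\ge 0$ is the binary expansion of $g$, then $e_g=\sum_{i=0}^st_i2^{t_i-1}+\sum_{i=0}^{s}i2^{t_i}$, independently of the choice of $G_n\in HL_n$.) -}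

module Defs where

open import Data.Nat using (ℕ; zero; suc; _+_; _*_; _^_; _⊔_; _<ᵇ_)
open import Data.Bool using (Bool; true; false; _∧_; if_then_else_)
open import Data.Fin using (Fin; toℕ)
open import Data.Fin.Properties using (_≟_)
open import Data.Vec using (Vec; []; _∷_; lookup)
open import Data.List using (List; []; _∷_; map; filter; foldr; allFin; _++_)
open import Data.Nat.ListAction using (sum)
open import Data.Sum using (_⊎_; inj₁; inj₂)
open import Data.Product using (Σ; _×_)
open import Data.Integer as ℤ using (ℤ; +_)
open import Function.Bundles using (_↔_; Inverse)
open import Relation.Nullary.Decidable using (⌊_⌋)
open import Relation.Binary.PropositionalEquality using (_≡_)
import Data.Nat.Properties as ℕP

Graph : ℕ → Set
Graph N = Fin N → Fin N → Bool

joinAdj : {m : ℕ} → Graph m → Graph m → (Fin m ↔ Fin m) →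
          (Fin m ⊎ Fin m) → (Fin m ⊎ Fin m) → Bool
joinAdj G H π (inj₁ a) (inj₁ b) = G a b
joinAdj G H π (inj₂ a) (inj₂ b) = H a b
joinAdj G H π (inj₁ a) (inj₂ b) = ⌊ Inverse.to π a ≟ b ⌋
joinAdj G H π (inj₂ b) (inj₁ a) = ⌊ Inverse.to π a ≟ b ⌋

-- Hypercube-like networks: HL n G means G ∈ HL_n (vertex set Fin (2^n),
-- graphs taken up to an arbitrary labelling of the vertices).
data HL : (n : ℕ) → Graph (2 ^ n) → Set where
  hl-base : (G : Graph 1) → (∀ x y → G x y ≡ false) → HL 0 G
  hl-step : {n : ℕ} {G H : Graph (2 ^ n)} {K : Graph (2 ^ suc n)} →
            HL n G → HL n H →
            (π : Fin (2 ^ n) ↔ Fin (2 ^ n)) →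
            (σ : Fin (2 ^ suc n) ↔ (Fin (2 ^ n) ⊎ Fin (2 ^ n))) →
            (∀ x y → K x y ≡ joinAdj G H π (Inverse.to σ x) (Inverse.to σ y)) →
            HL (suc n) K

Subset : ℕ → Set
Subset N = Vec Bool N

allSubsets : (N : ℕ) → List (Subset N)
allSubsets zero = [] ∷ []
allSubsets (suc N) = map (true ∷_) (allSubsets N) ++ map (false ∷_) (allSubsets N)

card : {N : ℕ} → Subset N → ℕ
card [] = 0
card (true ∷ S) = suc (card S)
card (false ∷ S) = card S

inducedEdges : {N : ℕ} → Graph N → Subset N → ℕ
inducedEdges {N} G S =
  sum (map (λ x → sum (map (λ y →
        if (toℕ x <ᵇ toℕ y) ∧ lookup S x ∧ lookup S y ∧ G x y then 1 else 0)
      (allFin N))) (allFin N))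

-- e_g : maximum number of edges of a subgraph of G induced by g vertices
-- (0 if there is no subset with g vertices, which never happens for 1 ≤ g ≤ N).
maxEdges : {N : ℕ} → Graph N → ℕ → ℕ
maxEdges {N} G g =
  foldr _⊔_ 0 (map (inducedEdges G)
    (filter (λ S → card S ℕP.≟ g) (allSubsets N)))

f : (n : ℕ) → Graph (2 ^ n) → ℕ → ℤ
f n G g = + (n * g) ℤ.- + (2 * maxEdges G g)

{-# OPTIONS --safe #-}
module Submission where

-- Let arcs K T count the ordered pairs of adjacent vertices of T, i.e. twice the number of
-- edges induced by T. Splitting T along the perfect matching of the last construction step,
-- its halves T₁ and T₂ contribute their own arcs plus at most 2·min(|T₁|, |T₂|) matching
-- arcs; by induction, arcs K T ≤ (l + 2)|T| − 2^(l+1) whenever 2^l ≤ |T| < 2^(l+1).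
-- A subcube of dimension r has r·2^r arcs. Hence f(g) ≥ (n − l − 2)g + 2^(l+1) and
-- f(2^r) ≤ (n − r)2^r; writing l = r + d and n − 1 = l + m, the difference is nonnegative
-- because 1 + d + m ≤ (1 + m)·2^d.

open import Defs
open import Data.Nat using (ℕ; _≤_; _<_; _^_; _∸_)
open import Data.Integer using () renaming (_≤_ to _≤ℤ_)

open import Data.Nat using (zero; suc; _+_; _*_; _<ᵇ_; _⊔_; z≤n; s≤s)
open import Data.Nat.Properties
open import Data.Nat.Tactic.RingSolver using (solve-∀)
import Data.Nat.ListAction as ListAction
open import Data.Integer as ℤ using (_⊖_)
import Data.Integer.Properties as ℤ
open import Data.Bool using (Bool; true; false; _∧_; if_then_else_)
open import Data.Bool.Properties using (∧-commutativeMonoid; ∧-identityʳ; ∧-zeroʳ; ∧-assoc)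
open import Data.Fin using (Fin; zero; suc; toℕ; splitAt; _↑ˡ_; _↑ʳ_)
open import Data.Fin.Properties using (toℕ-injective; splitAt-join; splitAt-↑ˡ; splitAt-↑ʳ; +↔⊎)
  renaming (_≟_ to _≟ᶠ_)
open import Data.Vec using ([]; _∷_; lookup; tabulate)
open import Data.Vec.Properties using (lookup∘tabulate)
import Data.List as List
open import Data.List using (map; filter; allFin)
import Data.List.Properties as List
open import Data.List.Properties using (foldr-preservesᵇ; foldr-preservesᵒ)
import Data.List.Relation.Unary.All as All
open import Data.List.Relation.Unary.All.Properties using (all-filter; map⁺)
import Data.List.Relation.Unary.Any as Any
open import Data.List.Relation.Unary.Any using (here)
open import Data.List.Membership.Propositional using (_∈_)
open import Data.List.Membership.Propositional.Properties using (∈-map⁺; ∈-++⁺ˡ; ∈-++⁺ʳ; ∈-filter⁺)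
open import Data.Product using (Σ-syntax; ∃-syntax; _×_; _,_)
open import Data.Sum using (_⊎_; inj₁; inj₂; [_,_]; [_,_]′)
open import Function using (_∘_; id; _↔_; Inverse)
open import Function.Properties.Inverse using (↔-sym; ↔-trans)
open import Relation.Nullary using (yes; no; contradiction)
open import Relation.Nullary.Decidable using (⌊_⌋; ⌊⌋-map′)
open import Relation.Nullary.Reflects using (ofʸ; ofⁿ)
open import Relation.Binary.PropositionalEquality hiding ([_])
open import Algebra.Bundles using (CommutativeMonoid)
open import Algebra.Properties.CommutativeSemigroup
  (CommutativeMonoid.commutativeSemigroup ∧-commutativeMonoid) using () renaming (x∙yz≈y∙xz to ∧-swap)
open import Algebra.Properties.CommutativeMonoid.Sum +-0-commutativeMonoid
  using (sum; sum-cong-≗; sum-replicate-zero; ∑-permute; ∑-comm; ∑-distrib-+)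

-- Finite sums over Fin

⟦_⟧ : Bool → ℕ
⟦ b ⟧ = if b then 1 else 0

sum-tabulate : ∀ {N} (t : Fin N → ℕ) → ListAction.sum (List.tabulate t) ≡ sum t
sum-tabulate {zero} t = refl
sum-tabulate {suc N} t = cong (t zero +_) (sum-tabulate (t ∘ suc))

sum-allFin : ∀ {N} (t : Fin N → ℕ) → ListAction.sum (List.map t (allFin N)) ≡ sum t
sum-allFin t = trans (cong ListAction.sum (List.map-tabulate id t)) (sum-tabulate t)

sum-const-1 : ∀ N → sum {N} (λ _ → 1) ≡ N
sum-const-1 zero = refl
sum-const-1 (suc N) = cong suc (sum-const-1 N)

sum-mono-≤ : ∀ {N} {t u : Fin N → ℕ} → (∀ i → t i ≤ u i) → sum t ≤ sum u
sum-mono-≤ {zero} _ = z≤n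
sum-mono-≤ {suc N} t≤u = +-mono-≤ (t≤u zero) (sum-mono-≤ (t≤u ∘ suc))

sum-δ : ∀ {N} (p : Fin N) (h : Fin N → Bool) → sum (λ b → ⟦ h b ∧ ⌊ p ≟ᶠ b ⌋ ⟧) ≡ ⟦ h p ⟧
sum-δ {suc N} zero h
  rewrite ∧-identityʳ (h zero)
        | sum-cong-≗ {N} (λ b → cong ⟦_⟧ (∧-zeroʳ (h (suc b))))
        | sum-replicate-zero N = +-identityʳ ⟦ h zero ⟧
sum-δ {suc N} (suc p) h = trans
  (cong₂ _+_ (cong ⟦_⟧ (∧-zeroʳ (h zero)))
             (sum-cong-≗ λ b → cong (λ z → ⟦ h (suc b) ∧ z ⟧) (⌊⌋-map′ _ _ (p ≟ᶠ b))))
  (sum-δ p (h ∘ suc))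

sum-↑ : ∀ m k (t : Fin (m + k) → ℕ) → sum t ≡ sum (t ∘ (_↑ˡ k)) + sum (t ∘ (m ↑ʳ_))
sum-↑ zero k t = refl
sum-↑ (suc m) k t = trans (cong (t zero +_) (sum-↑ m k (t ∘ suc))) (sym (+-assoc (t zero) _ _))

sum-reindex-⊎ : ∀ {N m k} (σ : Fin N ↔ (Fin m ⊎ Fin k)) (h : Fin m ⊎ Fin k → ℕ) →
                sum (h ∘ Inverse.to σ) ≡ sum (h ∘ inj₁) + sum (h ∘ inj₂)
sum-reindex-⊎ {N} {m} {k} σ h = begin
  sum (h ∘ Inverse.to σ)                      ≡⟨ sum-cong-≗ (λ x → cong h (splitAt-join m k (Inverse.to σ x))) ⟨
  sum (h′ ∘ Inverse.to τ)                     ≡⟨ ∑-permute h′ τ ⟨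
  sum h′                                      ≡⟨ sum-↑ m k h′ ⟩
  sum (h′ ∘ (_↑ˡ k)) + sum (h′ ∘ (m ↑ʳ_))     ≡⟨ cong₂ _+_ (sum-cong-≗ (λ a → cong h (splitAt-↑ˡ m a k)))
                                                          (sum-cong-≗ (λ b → cong h (splitAt-↑ʳ m k b))) ⟩
  sum (h ∘ inj₁) + sum (h ∘ inj₂)             ∎
  where
  open ≡-Reasoning
  h′ : Fin (m + k) → ℕ
  h′ = h ∘ splitAt m
  τ : Fin N ↔ Fin (m + k)
  τ = ↔-trans σ (↔-sym +↔⊎)

-- Powers of two and the chord bound

2^m≤n<2^[1+o]⇒m≤o : ∀ {m n o} → 2 ^ m ≤ n → n < 2 ^ suc o → m ≤ o
2^m≤n<2^[1+o]⇒m≤o 2^m≤n n<2^[1+o] =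
  ≮⇒≥ λ o<m → <⇒≱ n<2^[1+o] (≤-trans (^-monoʳ-≤ 2 o<m) 2^m≤n)

n<2^n : ∀ n → n < 2 ^ n
n<2^n zero = s≤s z≤n
n<2^n (suc n) = +-mono-≤ (m^n>0 2 n) (≤-trans (n<2^n n) (m≤m+n (2 ^ n) 0))

level : ∀ c → 1 ≤ c → ∃[ l ] 2 ^ l ≤ c × c < 2 ^ suc l
level c 1≤c = search c (n<2^n c)
  where
  search : ∀ k → c < 2 ^ k → ∃[ l ] 2 ^ l ≤ c × c < 2 ^ suc l
  search zero c<1 = contradiction c<1 (≤⇒≯ 1≤c)
  search (suc k) c<2^[1+k] with c <? 2 ^ k
  ... | yes c<2^k = search k c<2^k
  ... | no c≮2^k = k , ≮⇒≥ c≮2^k , c<2^[1+k]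

2^[1+j]≤m+n : ∀ {j m n} → 2 ^ j ≤ m → 2 ^ j ≤ n → 2 ^ suc j ≤ m + n
2^[1+j]≤m+n {j} 2^j≤m 2^j≤n = +-mono-≤ 2^j≤m (≤-trans (≤-reflexive (+-identityʳ (2 ^ j))) 2^j≤n)

m+n<2^[2+j] : ∀ {j m n} → m < 2 ^ suc j → n < 2 ^ suc j → m + n < 2 ^ suc (suc j)
m+n<2^[2+j] {j} m< n< = <-≤-trans (+-mono-< m< n<) (+-monoʳ-≤ (2 ^ suc j) (m≤m+n _ 0))

-- (2 + l)·c − 2^(1+l) is the chord of c ↦ 2e_c through the hypercube values l·2^l at
-- c = 2^l and (l + 1)·2^(1+l) at c = 2^(1+l).
record ArcBound (x c : ℕ) : Set where
  field
    empty : c ≡ 0 → x ≡ 0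
    chord : ∀ l → 2 ^ l ≤ c → c < 2 ^ suc l → x + 2 ^ suc l ≤ (2 + l) * c

open ArcBound

arcBound-zero : ∀ c → ArcBound 0 c
arcBound-zero c .empty _ = refl
arcBound-zero c .chord l 2^l≤c _ = ≤-trans (*-monoʳ-≤ 2 2^l≤c) (*-monoˡ-≤ c (m≤m+n 2 l))

chord⇒+c≤ : ∀ {x c} l → c < 2 ^ suc l → x + 2 ^ suc l ≤ (2 + l) * c → x + c ≤ (2 + l) * c
chord⇒+c≤ {x} l c< h = ≤-trans (+-monoʳ-≤ x (<⇒≤ c<)) h

chord-step : ∀ {x c} j → 2 ^ suc j ≤ c → x + 2 ^ suc j ≤ (2 + j) * c →
             x + 2 ^ suc (suc j) ≤ (3 + j) * c
chord-step {x} {c} j 2^[1+j]≤c h = begin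
  x + 2 * 2 ^ suc j             ≡⟨ split x (2 ^ suc j) ⟩
  (x + 2 ^ suc j) + 2 ^ suc j   ≤⟨ +-mono-≤ h 2^[1+j]≤c ⟩
  (2 + j) * c + c               ≡⟨ +-comm _ c ⟩
  (3 + j) * c                   ∎
  where
  open ≤-Reasoning
  split : ∀ x p → x + 2 * p ≡ (x + p) + p
  split = solve-∀

chord-merge : ∀ {x₁ x₂ X a b} j → x₁ + 2 ^ suc j ≤ (2 + j) * a → x₂ + 2 ^ suc j ≤ (2 + j) * b →
              2 * X ≤ a + b → x₁ + x₂ + 2 * X + 2 ^ suc (suc j) ≤ (3 + j) * (a + b)
chord-merge {x₁} {x₂} {X} {a} {b} j h₁ h₂ 2X≤a+b = begin
  x₁ + x₂ + 2 * X + 2 * 2 ^ suc j                   ≡⟨ regroup x₁ x₂ (2 * X) (2 ^ suc j) ⟩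
  (x₁ + 2 ^ suc j) + (x₂ + 2 ^ suc j) + 2 * X       ≤⟨ +-mono-≤ (+-mono-≤ h₁ h₂) 2X≤a+b ⟩
  (2 + j) * a + (2 + j) * b + (a + b)               ≡⟨ collect j a b ⟩
  (3 + j) * (a + b)                                 ∎
  where
  open ≤-Reasoning
  regroup : ∀ x₁ x₂ y p → x₁ + x₂ + y + 2 * p ≡ (x₁ + p) + (x₂ + p) + y
  regroup = solve-∀
  collect : ∀ j a b → (2 + j) * a + (2 + j) * b + (a + b) ≡ (3 + j) * (a + b)
  collect = solve-∀

chord-absorb : ∀ {x₁ x₂ X a b} i j → x₁ + a ≤ (2 + i) * a → i < j → X ≤ a →
               x₂ + 2 ^ suc j ≤ (2 + j) * b → x₁ + x₂ + 2 * X + 2 ^ suc j ≤ (2 + j) * (a + b)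
chord-absorb {x₁} {x₂} {X} {a} {b} i j h₁ i<j X≤a h₂ = begin
  x₁ + x₂ + 2 * X + 2 ^ suc j       ≡⟨ regroup x₁ x₂ (2 * X) (2 ^ suc j) ⟩
  (x₁ + 2 * X) + (x₂ + 2 ^ suc j)   ≤⟨ +-mono-≤ (+-monoʳ-≤ x₁ (*-monoʳ-≤ 2 X≤a)) h₂ ⟩
  (x₁ + 2 * a) + (2 + j) * b        ≡⟨ cong (_+ (2 + j) * b) (double x₁ a) ⟩
  (x₁ + a) + a + (2 + j) * b        ≤⟨ +-monoˡ-≤ ((2 + j) * b) (+-monoˡ-≤ a h₁) ⟩
  (2 + i) * a + a + (2 + j) * b     ≡⟨ cong (_+ (2 + j) * b) (+-comm _ a) ⟩
  (3 + i) * a + (2 + j) * b         ≤⟨ +-monoˡ-≤ ((2 + j) * b) (*-monoˡ-≤ a (s≤s (s≤s i<j))) ⟩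
  (2 + j) * a + (2 + j) * b         ≡⟨ *-distribˡ-+ (2 + j) a b ⟨
  (2 + j) * (a + b)                 ∎
  where
  open ≤-Reasoning
  regroup : ∀ x₁ x₂ y p → x₁ + x₂ + y + p ≡ (x₁ + y) + (x₂ + p)
  regroup = solve-∀
  double : ∀ x a → x + 2 * a ≡ (x + a) + a
  double = solve-∀

chord-lift : ∀ {x c} j {L} → j ≤ L → L ≤ suc j → 2 ^ L ≤ c →
             x + 2 ^ suc j ≤ (2 + j) * c → x + 2 ^ suc L ≤ (2 + L) * c
chord-lift {x} {c} j {L} j≤L L≤1+j 2^L≤c h with m≤n⇒m<n∨m≡n {j} {L} j≤L
... | inj₂ refl = h
... | inj₁ j<L with ≤-antisym {L} {suc j} L≤1+j j<L
...   | refl = chord-step {x} j 2^L≤c h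

-- A half on a lower level fits, together with the matching arcs, under the chord of the
-- larger half; two halves on the same level push the union one level up.
chord-join-pos : ∀ {x₁ x₂ X a b} L → ArcBound x₁ a → ArcBound x₂ b → X ≤ a → a ≤ b → 1 ≤ a →
                 2 ^ L ≤ a + b → a + b < 2 ^ suc L → x₁ + x₂ + 2 * X + 2 ^ suc L ≤ (2 + L) * (a + b)
chord-join-pos {x₁} {x₂} {X} {a} {b} L A₁ A₂ X≤a a≤b 1≤a 2^L≤a+b a+b<2^[1+L]
  with level a 1≤a | level b (≤-trans 1≤a a≤b)
... | i , 2^i≤a , a<2^[1+i] | j , 2^j≤b , b<2^[1+j]
  with m≤n⇒m<n∨m≡n {i} {j} (2^m≤n<2^[1+o]⇒m≤o 2^i≤a (≤-<-trans a≤b b<2^[1+j]))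
... | inj₁ i<j =
  chord-lift {x₁ + x₂ + 2 * X} {a + b} j j≤L L≤1+j 2^L≤a+b
    (chord-absorb {x₁} {x₂} {X} {a} {b} i j
      (chord⇒+c≤ {x₁} {a} i a<2^[1+i] (A₁ .chord i 2^i≤a a<2^[1+i])) i<j X≤a
      (A₂ .chord j 2^j≤b b<2^[1+j]))
  where
  j≤L : j ≤ L
  j≤L = 2^m≤n<2^[1+o]⇒m≤o (≤-trans 2^j≤b (m≤n+m b a)) a+b<2^[1+L]
  L≤1+j : L ≤ suc j
  L≤1+j = 2^m≤n<2^[1+o]⇒m≤o 2^L≤a+b
            (m+n<2^[2+j] {j} (<-≤-trans a<2^[1+i] (^-monoʳ-≤ 2 (s≤s (<⇒≤ i<j)))) b<2^[1+j])
... | inj₂ refl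
  with ≤-antisym {L} {suc i} (2^m≤n<2^[1+o]⇒m≤o 2^L≤a+b (m+n<2^[2+j] {i} a<2^[1+i] b<2^[1+j]))
                 (2^m≤n<2^[1+o]⇒m≤o (2^[1+j]≤m+n {i} 2^i≤a 2^j≤b) a+b<2^[1+L])
...   | refl = chord-merge {x₁} {x₂} {X} {a} {b} i
                 (A₁ .chord i 2^i≤a a<2^[1+i]) (A₂ .chord j 2^j≤b b<2^[1+j])
                 (+-mono-≤ X≤a (≤-trans (≤-reflexive (+-identityʳ X)) (≤-trans X≤a a≤b)))

chord-join : ∀ {x₁ x₂ X a b} L → ArcBound x₁ a → ArcBound x₂ b → X ≤ a → a ≤ b →
             2 ^ L ≤ a + b → a + b < 2 ^ suc L → x₁ + x₂ + 2 * X + 2 ^ suc L ≤ (2 + L) * (a + b)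
chord-join {x₂ = x₂} {a = zero} L A₁ A₂ z≤n _ rewrite A₁ .empty refl | +-identityʳ x₂ = A₂ .chord L
chord-join {a = suc _} L A₁ A₂ X≤a a≤b = chord-join-pos L A₁ A₂ X≤a a≤b (s≤s z≤n)

arcBound-join : ∀ {x₁ x₂ X a b} → ArcBound x₁ a → ArcBound x₂ b → X ≤ a → X ≤ b →
                ArcBound (x₁ + x₂ + 2 * X) (a + b)
arcBound-join {a = a} A₁ A₂ X≤a X≤b .empty a+b≡0
  rewrite A₁ .empty (m+n≡0⇒m≡0 a a+b≡0) | A₂ .empty (m+n≡0⇒n≡0 a a+b≡0)
        | n≤0⇒n≡0 (≤-trans X≤a (≤-reflexive (m+n≡0⇒m≡0 a a+b≡0))) = refl
arcBound-join {x₁} {x₂} {X} {a} {b} A₁ A₂ X≤a X≤b .chord L with ≤-total a b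
... | inj₁ a≤b = chord-join L A₁ A₂ X≤a a≤b
... | inj₂ b≤a rewrite +-comm x₁ x₂ | +-comm a b = chord-join L A₂ A₁ X≤b b≤a

-- Arcs in vertex subsets of HL-networks

size : ∀ {N} → (Fin N → Bool) → ℕ
size T = sum (λ x → ⟦ T x ⟧)

arcs : ∀ {N} → Graph N → (Fin N → Bool) → ℕ
arcs K T = sum (λ x → sum (λ y → ⟦ T x ∧ T y ∧ K x y ⟧))

size-cong : ∀ {N} {T T′ : Fin N → Bool} → (∀ x → T x ≡ T′ x) → size T ≡ size T′
size-cong T≗T′ = sum-cong-≗ (cong ⟦_⟧ ∘ T≗T′)

arcs-cong : ∀ {N} (K : Graph N) {T T′ : Fin N → Bool} → (∀ x → T x ≡ T′ x) → arcs K T ≡ arcs K T′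
arcs-cong K T≗T′ = sum-cong-≗ λ x → sum-cong-≗ λ y →
  cong₂ (λ s t → ⟦ s ∧ t ∧ K x y ⟧) (T≗T′ x) (T≗T′ y)

arcs-edgeless : ∀ {N} (K : Graph N) (T : Fin N → Bool) → (∀ x y → K x y ≡ false) → arcs K T ≡ 0
arcs-edgeless {N} K T no-edge =
  trans (sum-cong-≗ λ x → trans (sum-cong-≗ λ y → cong ⟦_⟧ (no-arc x y)) (sum-replicate-zero N))
        (sum-replicate-zero N)
  where
  no-arc : ∀ x y → (T x ∧ T y ∧ K x y) ≡ false
  no-arc x y rewrite no-edge x y | ∧-zeroʳ (T y) = ∧-zeroʳ (T x)

module Join {N m : ℕ} (G H : Graph m) (π : Fin m ↔ Fin m) (σ : Fin N ↔ (Fin m ⊎ Fin m))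
            {K : Graph N} (K≡join : ∀ x y → K x y ≡ joinAdj G H π (Inverse.to σ x) (Inverse.to σ y))
            (U : Fin m ⊎ Fin m → Bool) where

  U₁ U₂ : Fin m → Bool
  U₁ = U ∘ inj₁
  U₂ = U ∘ inj₂

  matched : ℕ
  matched = sum (λ a → ⟦ U₁ a ∧ U₂ (Inverse.to π a) ⟧)

  size-join : size (U ∘ Inverse.to σ) ≡ size U₁ + size U₂
  size-join = sum-reindex-⊎ σ (⟦_⟧ ∘ U)

  private
    W : Fin m ⊎ Fin m → Fin m ⊎ Fin m → ℕ
    W u v = ⟦ U u ∧ U v ∧ joinAdj G H π u v ⟧

    block : (Fin m → Fin m ⊎ Fin m) → (Fin m → Fin m ⊎ Fin m) → ℕ
    block ι κ = sum (λ a → sum (λ b → W (ι a) (κ b)))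

    cross₁₂ : block inj₁ inj₂ ≡ matched
    cross₁₂ = sum-cong-≗ λ a → trans
      (sum-cong-≗ λ b → cong ⟦_⟧ (sym (∧-assoc (U₁ a) (U₂ b) _)))
      (sum-δ (Inverse.to π a) (λ b → U₁ a ∧ U₂ b))

    cross₂₁ : block inj₂ inj₁ ≡ block inj₁ inj₂
    cross₂₁ = trans (∑-comm (λ a b → W (inj₂ a) (inj₁ b)))
      (sum-cong-≗ λ a → sum-cong-≗ λ b → cong ⟦_⟧ (∧-swap (U₂ b) (U₁ a) _))

    blocks : arcs K (U ∘ Inverse.to σ)
             ≡ (block inj₁ inj₁ + block inj₁ inj₂) + (block inj₂ inj₁ + block inj₂ inj₂)
    blocks = begin
      arcs K (U ∘ Inverse.to σ)
        ≡⟨ sum-cong-≗ (λ x → sum-cong-≗ λ y → cong (λ e → ⟦ U (to x) ∧ U (to y) ∧ e ⟧) (K≡join x y)) ⟩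
      sum (λ x → sum (λ y → W (to x) (to y)))
        ≡⟨ sum-cong-≗ (λ x → sum-reindex-⊎ σ (W (to x))) ⟩
      sum (λ x → sum (λ b → W (to x) (inj₁ b)) + sum (λ b → W (to x) (inj₂ b)))
        ≡⟨ sum-reindex-⊎ σ (λ u → sum (λ b → W u (inj₁ b)) + sum (λ b → W u (inj₂ b))) ⟩
      sum (λ a → sum (λ b → W (inj₁ a) (inj₁ b)) + sum (λ b → W (inj₁ a) (inj₂ b)))
        + sum (λ a → sum (λ b → W (inj₂ a) (inj₁ b)) + sum (λ b → W (inj₂ a) (inj₂ b)))
        ≡⟨ cong₂ _+_ (rows inj₁) (rows inj₂) ⟩
      (block inj₁ inj₁ + block inj₁ inj₂) + (block inj₂ inj₁ + block inj₂ inj₂) ∎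
      where
      open ≡-Reasoning
      to : Fin N → Fin m ⊎ Fin m
      to = Inverse.to σ
      rows : ∀ ι → sum (λ a → sum (λ b → W (ι a) (inj₁ b)) + sum (λ b → W (ι a) (inj₂ b)))
                   ≡ block ι inj₁ + block ι inj₂
      rows ι = ∑-distrib-+ (λ a → sum (λ b → W (ι a) (inj₁ b))) (λ a → sum (λ b → W (ι a) (inj₂ b)))

  arcs-join : arcs K (U ∘ Inverse.to σ) ≡ arcs G U₁ + arcs H U₂ + 2 * matched
  arcs-join = begin
    arcs K (U ∘ Inverse.to σ)                                      ≡⟨ blocks ⟩
    (arcs G U₁ + block inj₁ inj₂) + (block inj₂ inj₁ + arcs H U₂)  ≡⟨ cong₂ (λ p q → (arcs G U₁ + p) + (q + arcs H U₂))
                                                                            cross₁₂ (trans cross₂₁ cross₁₂) ⟩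
    (arcs G U₁ + matched) + (matched + arcs H U₂)                  ≡⟨ regroup (arcs G U₁) (arcs H U₂) matched ⟩
    arcs G U₁ + arcs H U₂ + 2 * matched                            ∎
    where
    open ≡-Reasoning
    regroup : ∀ x y z → (x + z) + (z + y) ≡ x + y + 2 * z
    regroup = solve-∀

  matched≤size₁ : matched ≤ size U₁
  matched≤size₁ = sum-mono-≤ λ a → ⟦s∧t⟧≤⟦s⟧ (U₁ a) _
    where
    ⟦s∧t⟧≤⟦s⟧ : ∀ s t → ⟦ s ∧ t ⟧ ≤ ⟦ s ⟧
    ⟦s∧t⟧≤⟦s⟧ true  true  = ≤-refl
    ⟦s∧t⟧≤⟦s⟧ true  false = z≤n
    ⟦s∧t⟧≤⟦s⟧ false _     = z≤n

  matched≤size₂ : matched ≤ size U₂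
  matched≤size₂ = begin
    matched                              ≤⟨ sum-mono-≤ (λ a → ⟦s∧t⟧≤⟦t⟧ (U₁ a) _) ⟩
    sum (λ a → ⟦ U₂ (Inverse.to π a) ⟧)  ≡⟨ ∑-permute (⟦_⟧ ∘ U₂) π ⟨
    size U₂                              ∎
    where
    open ≤-Reasoning
    ⟦s∧t⟧≤⟦t⟧ : ∀ s t → ⟦ s ∧ t ⟧ ≤ ⟦ t ⟧
    ⟦s∧t⟧≤⟦t⟧ true  _ = ≤-refl
    ⟦s∧t⟧≤⟦t⟧ false _ = z≤n

HL-symmetric : ∀ {n K} → HL n K → ∀ x y → K x y ≡ K y x
HL-symmetric (hl-base G no-edge) x y = trans (no-edge x y) (sym (no-edge y x))
HL-symmetric (hl-step {G = G} {H} hG hH π σ K≡join) x y =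
  trans (K≡join x y) (trans (join-sym (Inverse.to σ x) (Inverse.to σ y)) (sym (K≡join y x)))
  where
  join-sym : ∀ u v → joinAdj G H π u v ≡ joinAdj G H π v u
  join-sym (inj₁ a) (inj₁ b) = HL-symmetric hG a b
  join-sym (inj₁ a) (inj₂ b) = refl
  join-sym (inj₂ a) (inj₁ b) = refl
  join-sym (inj₂ a) (inj₂ b) = HL-symmetric hH a b

HL-irreflexive : ∀ {n K} → HL n K → ∀ x → K x x ≡ false
HL-irreflexive (hl-base G no-edge) x = no-edge x x
HL-irreflexive (hl-step {G = G} {H} hG hH π σ K≡join) x = trans (K≡join x x) (join-irr (Inverse.to σ x))
  where
  join-irr : ∀ u → joinAdj G H π u u ≡ false
  join-irr (inj₁ a) = HL-irreflexive hG a
  join-irr (inj₂ a) = HL-irreflexive hH a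

arcBound-HL : ∀ {n K} → HL n K → ∀ T → ArcBound (arcs K T) (size T)
arcBound-HL (hl-base G no-edge) T =
  subst (λ x → ArcBound x (size T)) (sym (arcs-edgeless G T no-edge)) (arcBound-zero (size T))
arcBound-HL (hl-step {G = G} {H} {K} hG hH π σ K≡join) T =
  subst₂ ArcBound (trans (sym arcs-join) (arcs-cong K T≗)) (trans (sym size-join) (size-cong T≗))
    (arcBound-join (arcBound-HL hG U₁) (arcBound-HL hH U₂) matched≤size₁ matched≤size₂)
  where
  open Join G H π σ K≡join (T ∘ Inverse.from σ)
  T≗ : ∀ x → T (Inverse.from σ (Inverse.to σ x)) ≡ T x
  T≗ x = cong T (Inverse.inverseʳ σ refl)

arcs-full : ∀ {n K} → HL n K → n * 2 ^ n ≤ arcs K (λ _ → true)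
arcs-full (hl-base _ _) = z≤n
arcs-full {suc n} (hl-step {G = G} {H} {K} hG hH π σ K≡join) = begin
  suc n * 2 ^ suc n                                              ≡⟨ halves n (2 ^ n) ⟩
  n * 2 ^ n + n * 2 ^ n + 2 * 2 ^ n                              ≤⟨ +-mono-≤ (+-mono-≤ (arcs-full hG) (arcs-full hH))
                                                                     (≤-reflexive (cong (2 *_) (sym (sum-const-1 (2 ^ n))))) ⟩
  arcs G (λ _ → true) + arcs H (λ _ → true) + 2 * matched       ≡⟨ arcs-join ⟨
  arcs K (λ _ → true)                                            ∎
  where
  open ≤-Reasoning
  open Join G H π σ K≡join (λ _ → true)
  halves : ∀ n p → suc n * (2 * p) ≡ n * p + n * p + 2 * p
  halves = solve-∀

subcube : ∀ {n K} → HL n K → ∀ {r} → r ≤ n →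
          Σ[ T ∈ (Fin (2 ^ n) → Bool) ] size T ≡ 2 ^ r × r * 2 ^ r ≤ arcs K T
subcube hl r≤n with m≤n⇒m<n∨m≡n r≤n
... | inj₂ refl = (λ _ → true) , sum-const-1 _ , arcs-full hl
subcube (hl-step {n} {G} {H} {K} hG hH π σ K≡join) {r} _ | inj₁ (s≤s r≤n) with subcube hG r≤n
... | T , |T|≡2^r , r2^r≤arcs = U ∘ Inverse.to σ , size-U , arcs-U
  where
  U : Fin (2 ^ n) ⊎ Fin (2 ^ n) → Bool
  U = [ T , (λ _ → false) ]
  open Join G H π σ K≡join U
  size-U : size (U ∘ Inverse.to σ) ≡ 2 ^ r
  size-U = trans size-join (trans (cong₂ _+_ |T|≡2^r (sum-replicate-zero (2 ^ n))) (+-identityʳ (2 ^ r)))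
  arcs-U : r * 2 ^ r ≤ arcs K (U ∘ Inverse.to σ)
  arcs-U = ≤-trans r2^r≤arcs (≤-trans (≤-trans (m≤m+n (arcs G T) _) (m≤m+n _ (2 * matched)))
                                       (≤-reflexive (sym arcs-join)))

-- Induced edges and e_g

card≡size : ∀ {N} (S : Subset N) → card S ≡ size (lookup S)
card≡size [] = refl
card≡size (true ∷ S) = cong suc (card≡size S)
card≡size (false ∷ S) = card≡size S

⟦<∧b⟧+⟦>∧b⟧≡⟦b⟧ : ∀ {N} (x y : Fin N) b → (x ≡ y → b ≡ false) →
                  ⟦ (toℕ x <ᵇ toℕ y) ∧ b ⟧ + ⟦ (toℕ y <ᵇ toℕ x) ∧ b ⟧ ≡ ⟦ b ⟧
⟦<∧b⟧+⟦>∧b⟧≡⟦b⟧ x y b x≡y⇒¬b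
  with toℕ x <ᵇ toℕ y | <ᵇ-reflects-< (toℕ x) (toℕ y) | toℕ y <ᵇ toℕ x | <ᵇ-reflects-< (toℕ y) (toℕ x)
... | true  | ofʸ x<y | true  | ofʸ y<x = contradiction y<x (<-asym x<y)
... | true  | _       | false | _       = +-identityʳ ⟦ b ⟧
... | false | _       | true  | _       = refl
... | false | ofⁿ x≮y | false | ofⁿ y≮x =
  cong ⟦_⟧ (sym (x≡y⇒¬b (toℕ-injective (≤-antisym (≮⇒≥ y≮x) (≮⇒≥ x≮y)))))

2*inducedEdges≡arcs : ∀ {N} (K : Graph N) → (∀ x y → K x y ≡ K y x) → (∀ x → K x x ≡ false) →
                      (S : Subset N) → 2 * inducedEdges K S ≡ arcs K (lookup S)
2*inducedEdges≡arcs {N} K K-sym K-irr S = begin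
  2 * inducedEdges K S                          ≡⟨ cong (2 *_) ordered ⟩
  2 * Σ<                                        ≡⟨ cong (Σ< +_) (+-identityʳ Σ<) ⟩
  Σ< + Σ<                                       ≡⟨ cong (Σ< +_) reversed ⟨
  Σ< + sum (λ x → sum (λ y → forward y x))      ≡⟨ ∑-distrib-+ (λ x → sum (forward x)) _ ⟨
  sum (λ x → sum (forward x) + sum (λ y → forward y x))
                                                ≡⟨ sum-cong-≗ (λ x → ∑-distrib-+ (forward x) _) ⟨
  sum (λ x → sum (λ y → forward x y + forward y x))
                                                ≡⟨ sum-cong-≗ (λ x → sum-cong-≗ λ y → split x y) ⟩
  arcs K (lookup S)                             ∎
  where
  open ≡-Reasoning
  adj : Fin N → Fin N → Bool
  adj x y = lookup S x ∧ lookup S y ∧ K x y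
  forward : Fin N → Fin N → ℕ
  forward x y = ⟦ (toℕ x <ᵇ toℕ y) ∧ adj x y ⟧
  Σ< : ℕ
  Σ< = sum (λ x → sum (forward x))
  ordered : inducedEdges K S ≡ Σ<
  ordered = trans (sum-allFin (λ x → ListAction.sum (map (forward x) (allFin N))))
                  (sum-cong-≗ λ x → sum-allFin (forward x))
  reversed : sum (λ x → sum (λ y → forward y x)) ≡ Σ<
  reversed = ∑-comm (λ x y → forward y x)
  adj-sym : ∀ x y → adj y x ≡ adj x y
  adj-sym x y rewrite K-sym y x = ∧-swap (lookup S y) (lookup S x) (K x y)
  split : ∀ x y → forward x y + forward y x ≡ ⟦ adj x y ⟧
  split x y rewrite adj-sym x y = ⟦<∧b⟧+⟦>∧b⟧≡⟦b⟧ x y (adj x y) λ { refl → diag x }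
    where
    diag : ∀ x → adj x x ≡ false
    diag x rewrite K-irr x | ∧-zeroʳ (lookup S x) = ∧-zeroʳ (lookup S x)

allSubsets-complete : ∀ {N} (S : Subset N) → S ∈ allSubsets N
allSubsets-complete [] = here refl
allSubsets-complete {suc N} (true ∷ S) = ∈-++⁺ˡ (∈-map⁺ (true ∷_) (allSubsets-complete S))
allSubsets-complete {suc N} (false ∷ S) =
  ∈-++⁺ʳ (map (true ∷_) (allSubsets N)) (∈-map⁺ (false ∷_) (allSubsets-complete S))

inducedEdges≤maxEdges : ∀ {N} (K : Graph N) (S : Subset N) → inducedEdges K S ≤ maxEdges K (card S)
inducedEdges≤maxEdges {N} K S =
  foldr-preservesᵒ {P = inducedEdges K S ≤_} (λ a b → [ m≤n⇒m≤n⊔o b , m≤n⇒m≤o⊔n a ]′) 0 _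
    (inj₂ (Any.map ≤-reflexive (∈-map⁺ (inducedEdges K) S∈g-subsets)))
  where
  S∈g-subsets : S ∈ filter (λ S′ → card S′ ≟ card S) (allSubsets N)
  S∈g-subsets = ∈-filter⁺ (λ S′ → card S′ ≟ card S) (allSubsets-complete S) refl

maxEdges-closed : ∀ {N} (K : Graph N) g (P : ℕ → Set) → P 0 →
                  (∀ S → card S ≡ g → P (inducedEdges K S)) → P (maxEdges K g)
maxEdges-closed {N} K g P P0 P-edges =
  foldr-preservesᵇ {P = P} ⊔-closed P0
    (map⁺ (All.map (λ {S} → P-edges S) (all-filter (λ S → card S ≟ g) (allSubsets N))))
  where
  ⊔-closed : ∀ {a b} → P a → P b → P (a ⊔ b)
  ⊔-closed {a} {b} Pa Pb = [ (λ e → subst P (sym e) Pa) , (λ e → subst P (sym e) Pb) ]′ (⊔-sel a b)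

2*maxEdges-upper : ∀ {n K} → HL n K → ∀ g → ArcBound (2 * maxEdges K g) g
2*maxEdges-upper {K = K} hl g = maxEdges-closed K g (λ e → ArcBound (2 * e) g) (arcBound-zero g)
  λ S |S|≡g → subst₂ ArcBound (sym (2*inducedEdges≡arcs K (HL-symmetric hl) (HL-irreflexive hl) S))
                              (trans (sym (card≡size S)) |S|≡g) (arcBound-HL hl (lookup S))

2*maxEdges-lower : ∀ {n K} → HL n K → ∀ {r} → r ≤ n → r * 2 ^ r ≤ 2 * maxEdges K (2 ^ r)
2*maxEdges-lower {n} {K} hl {r} r≤n with subcube hl r≤n
... | T , |T|≡2^r , r2^r≤arcs = begin
  r * 2 ^ r                 ≤⟨ r2^r≤arcs ⟩
  arcs K T                  ≡⟨ arcs-cong K (λ x → sym (lookup∘tabulate T x)) ⟩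
  arcs K (lookup S)         ≡⟨ 2*inducedEdges≡arcs K (HL-symmetric hl) (HL-irreflexive hl) S ⟨
  2 * inducedEdges K S      ≤⟨ *-monoʳ-≤ 2 (inducedEdges≤maxEdges K S) ⟩
  2 * maxEdges K (card S)   ≡⟨ cong (λ g → 2 * maxEdges K g) |S|≡2^r ⟩
  2 * maxEdges K (2 ^ r)    ∎
  where
  open ≤-Reasoning
  S : Subset (2 ^ n)
  S = tabulate T
  |S|≡2^r : card S ≡ 2 ^ r
  |S|≡2^r = trans (card≡size S) (trans (size-cong (lookup∘tabulate T)) |T|≡2^r)

-- Comparing f(2^r) with f(g)

g+m*L≤L+m*g : ∀ m {L g} → L ≤ g → g ≤ 2 ^ m * L → g + m * L ≤ L + m * g
g+m*L≤L+m*g zero {L} {g} _ g≤L = ≤-trans (≤-reflexive (+-identityʳ g)) g≤L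
g+m*L≤L+m*g (suc m) {L} {g} L≤g _ = begin
  g + (L + m * L)   ≡⟨ x+[y+z]≡y+[x+z] g L (m * L) ⟩
  L + (g + m * L)   ≤⟨ +-monoʳ-≤ L (+-monoʳ-≤ g (*-monoʳ-≤ m L≤g)) ⟩
  L + (g + m * g)   ∎
  where
  open ≤-Reasoning
  x+[y+z]≡y+[x+z] : ∀ x y z → x + (y + z) ≡ y + (x + z)
  x+[y+z]≡y+[x+z] = solve-∀

[1+d+m]*2^r≤[1+m]*2^[r+d] : ∀ r d m → (suc d + m) * 2 ^ r ≤ suc m * 2 ^ (r + d)
[1+d+m]*2^r≤[1+m]*2^[r+d] r d m = begin
  (suc d + m) * 2 ^ r         ≤⟨ *-monoˡ-≤ (2 ^ r) (≤-trans (m≤m+n (suc d + m) (m * d)) (≤-reflexive (expand d m))) ⟩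
  (suc m * suc d) * 2 ^ r     ≤⟨ *-monoˡ-≤ (2 ^ r) (*-monoʳ-≤ (suc m) (n<2^n d)) ⟩
  (suc m * 2 ^ d) * 2 ^ r     ≡⟨ reassoc (suc m) (2 ^ d) (2 ^ r) ⟩
  suc m * (2 ^ r * 2 ^ d)     ≡⟨ cong (suc m *_) (^-distribˡ-+-* 2 r d) ⟨
  suc m * 2 ^ (r + d)         ∎
  where
  open ≤-Reasoning
  expand : ∀ d m → suc d + m + m * d ≡ suc m * suc d
  expand = solve-∀
  reassoc : ∀ a b c → (a * b) * c ≡ a * (c * b)
  reassoc = solve-∀

[1+n]*2^r+x≤[1+n]*g+y : ∀ n r l {g x y} → 2 ^ r ≤ g → 2 ^ l ≤ g → g < 2 ^ suc l → g ≤ 2 ^ n →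
      x + 2 ^ suc l ≤ (2 + l) * g → r * 2 ^ r ≤ y → suc n * 2 ^ r + x ≤ suc n * g + y
[1+n]*2^r+x≤[1+n]*g+y n r l {g} {x} {y} 2^r≤g 2^l≤g g<2^[1+l] g≤2^n hx hy
  with m≤n⇒∃[o]m+o≡n {r} {l} (2^m≤n<2^[1+o]⇒m≤o 2^r≤g g<2^[1+l])
     | m≤n⇒∃[o]m+o≡n {l} {n}
         (2^m≤n<2^[1+o]⇒m≤o 2^l≤g (≤-<-trans g≤2^n (^-monoʳ-< 2 (s≤s (s≤s z≤n)) (n<1+n n))))
... | d , refl | m , refl = +-cancelʳ-≤ (2 * L) _ _ (begin
  suc n * R + x + 2 * L                   ≡⟨ split-n r d m R x L ⟩
  r * R + (suc d + m) * R + (x + 2 * L)   ≤⟨ +-mono-≤ (+-monoʳ-≤ (r * R) ([1+d+m]*2^r≤[1+m]*2^[r+d] r d m)) hx ⟩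
  r * R + suc m * L + (2 + l) * g         ≡⟨ split-l r d m R L g ⟩
  r * R + (L + suc l * g) + (g + m * L)   ≤⟨ +-monoʳ-≤ (r * R + (L + suc l * g)) (g+m*L≤L+m*g m 2^l≤g g≤2^m*L) ⟩
  r * R + (L + suc l * g) + (L + m * g)   ≡⟨ merge r d m R L g ⟩
  suc n * g + r * R + 2 * L               ≤⟨ +-monoˡ-≤ (2 * L) (+-monoʳ-≤ (suc n * g) hy) ⟩
  suc n * g + y + 2 * L                   ∎)
  where
  open ≤-Reasoning
  R L : ℕ
  R = 2 ^ r
  L = 2 ^ l
  g≤2^m*L : g ≤ 2 ^ m * L
  g≤2^m*L = ≤-trans g≤2^n (≤-reflexive (trans (^-distribˡ-+-* 2 l m) (*-comm L (2 ^ m))))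
  split-n : ∀ r d m R x L →
            suc (r + d + m) * R + x + 2 * L ≡ r * R + (suc d + m) * R + (x + 2 * L)
  split-n = solve-∀
  split-l : ∀ r d m R L g →
            r * R + suc m * L + (2 + (r + d)) * g ≡ r * R + (L + suc (r + d) * g) + (g + m * L)
  split-l = solve-∀
  merge : ∀ r d m R L g →
          r * R + (L + suc (r + d) * g) + (L + m * g) ≡ suc (r + d + m) * g + r * R + 2 * L
  merge = solve-∀

+m-+n≤+o-+p : ∀ {m n o p} → m + p ≤ o + n → ℤ.+ m ℤ.- ℤ.+ n ≤ℤ ℤ.+ o ℤ.- ℤ.+ p
+m-+n≤+o-+p {m} {n} {o} {p} m+p≤o+n = begin
  ℤ.+ m ℤ.- ℤ.+ n       ≡⟨ ℤ.m-n≡m⊖n m n ⟩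
  m ⊖ n                 ≡⟨ ℤ.+-cancelˡ-⊖ p m n ⟨
  (p + m) ⊖ (p + n)     ≤⟨ ℤ.⊖-monoˡ-≤ (p + n) (subst₂ _≤_ (+-comm m p) (+-comm o n) m+p≤o+n) ⟩
  (n + o) ⊖ (p + n)     ≡⟨ cong ((n + o) ⊖_) (+-comm p n) ⟩
  (n + o) ⊖ (n + p)     ≡⟨ ℤ.+-cancelˡ-⊖ n o p ⟩
  o ⊖ p                 ≡⟨ ℤ.m-n≡m⊖n o p ⟨
  ℤ.+ o ℤ.- ℤ.+ p       ∎
  where open ℤ.≤-Reasoning

lemma2p6 : (n r : ℕ) → 1 ≤ n → r ≤ n ∸ 1 →
    (G : Graph (2 ^ n)) → HL n G →
    (g : ℕ) → 2 ^ r ≤ g → g ≤ 2 ^ (n ∸ 1) →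
    f n G (2 ^ r) ≤ℤ f n G g
lemma2p6 (suc n) r _ r≤n G hl g 2^r≤g g≤2^n with level g (≤-trans (m^n>0 2 r) 2^r≤g)
... | l , 2^l≤g , g<2^[1+l] =
  +m-+n≤+o-+p {suc n * 2 ^ r} {2e (2 ^ r)} {suc n * g} {2e g}
    ([1+n]*2^r+x≤[1+n]*g+y n r l 2^r≤g 2^l≤g g<2^[1+l] g≤2^n
      (2*maxEdges-upper hl g .chord l 2^l≤g g<2^[1+l])
      (2*maxEdges-lower hl (m≤n⇒m≤1+n r≤n)))
  where
  2e : ℕ → ℕ
  2e h = 2 * maxEdges G h
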